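{- Let $G$ be a parity game, $\sigma$ a player and $k\ge0$ an integer. Then $\mathrm{TDA}(G,\sigma,k)$ returns the largest (possibly empty) set $S$ such that, if $\sigma$ uses $S$ as its first move in the trap-depth game on $G$ in which $\sigma$ goes first, $\sigma$ can guarantee a win within at most $k$ rounds.
   Context: A parity game $G=(V,E,p)$: finite directed graph in which every vertex has an outgoing edge, with priorities $p:V\to\mathbb Z$; vertices of even priority belong to player Even, odd ones to Odd; $V_\sigma$ is the set of vertices of player $\sigma$, $\overline\sigma$ the opponent, $N(v)$ the successors of $v$. For $S\subseteq V$, $\max(S)$ is the set of vertices of maximum priority in $S$ and, when all elements of $S$ share one priority, $p(S)$ denotes it. A $\sigma$-trap is a set $X\subseteq V$ such that every $\sigma$-vertex in $X$ has all successors in $X$ and every $\overline\sigma$-vertex in $X$ has some successor in $X$; $G[X]$ is the induced subgraph. Trap-depth game on $G$ in which $\sigma$ goes first: $G_1=G$; in round $i\ge1$, $\sigma$ picks a nonempty $\overline\sigma$-trap $X_i$ of $G_i$ with $\max(X_i)\subseteq V_\sigma$, then $\overline\sigma$ picks a nonempty $\sigma$-trap $Y_i$ of $G_i[X_i]$ with $\max(Y_i)\subseteq V_{\overline\sigma}$, and $G_{i+1}=G_i[Y_i]$; the first player with no legal move loses; "win within $k$ rounds" means $\overline\sigma$ has no legal move at some round $\le k$. Algorithms (all neighborhoods taken in the graph given as argument): $\mathrm{Attr}(G,X,\sigma)$ is the least $C\supseteq X$ such that every $v\in V_\sigma$ with $N(v)\cap C\neq\emptyset$ and every $v\in V_{\overline\sigma}$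 with $N(v)\subseteq C$ lies in $C$. $\mathrm{SafeAttr}(G,\lambda,X,\sigma)$ is the least $C\supseteq X$ containing every $v\in V_\sigma$ with $p(v)<\lambda$ and $N(v)\cap C\ne\emptyset$ and every $v\in V_{\overline\sigma}$ with $p(v)<\lambda$ and $N(v)\subseteq C$. $\mathrm{Restrict}(G,\lambda,\sigma)=V\setminus\mathrm{Attr}(G,\{v:p(v)\ge\lambda\},\overline\sigma)$. For an algorithm ParAlg mapping (parity game, player) to a vertex set: $\mathrm{GenAttr}(G,\lambda,X,\sigma,\mathrm{ParAlg})$: start with $C:=X$; repeatedly set $S:=\mathrm{SafeAttr}(G,\lambda,C,\sigma)$, $V':=\mathrm{Restrict}(G[V\setminus S],\lambda,\sigma)$, $C':=S\cup\mathrm{ParAlg}(G[V'],\sigma)$, stopping and returning $C'$ when $C'=C$, otherwise $C:=C'$. $\mathrm{SeqAttr}(G,X,\sigma,\mathrm{ParAlg})$: $W:=V_\sigma\cap X$, $C:=\emptyset$; while $W\neq\emptyset$: $S:=\max(W)$, $C:=\mathrm{GenAttr}(G,p(S),C\cup S,\sigma,\mathrm{ParAlg})$, $W:=W\setminus C$; return $C$. $\mathrm{TDA}(G,\sigma,\mathrm{ParAlg})$: $T:=V_\sigma$; repeatedly set $C:=\mathrm{SeqAttr}(G,T,\sigma,\mathrm{ParAlg})$ and $T':=T\setminus\{v\in V_\sigma:N(v)\cap C=\emptyset\}$, stopping and returning $C$ when $T'=T$, otherwise $T:=T'$. Finally $\mathrm{TDA}_0(G,\sigma)=\emptyset$, $\mathrm{TDA}_{k+1}(G,\sigma)=\mathrm{TDA}(G,\sigma,\mathrm{TDA}_k)$,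 and $\mathrm{TDA}(G,\sigma,k):=\mathrm{TDA}_k(G,\sigma)$. -}

module Defs where

open import Data.Nat using (ℕ; zero; suc; _%_; _≡ᵇ_)
open import Data.Integer using (ℤ; ∣_∣) renaming (_≤_ to _≤ℤ_; _<_ to _<ℤ_; _≤?_ to _≤ℤ?_; _≟_ to _≟ℤ_)
open import Data.Bool using (Bool; true; false; _∧_; if_then_else_; not)
open import Data.Fin using (Fin)
open import Data.Fin.Subset
  using (Subset; _∈_; _∉_; _⊆_; _∩_; _∪_; _─_; Nonempty; Empty)
  renaming (⊥ to ∅; ⊤ to Full)
open import Data.Vec using (tabulate; lookup)
open import Data.Product using (Σ; ∃; _×_; _,_)
open import Data.Empty renaming (⊥ to False)
open import Relation.Nullary using (¬_; ⌊_⌋)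
open import Relation.Binary.PropositionalEquality using (_≡_; _≢_)

record Game (n : ℕ) : Set where
  field
    succ  : Fin n → Subset n
    prio  : Fin n → ℤ
    total : ∀ v → Nonempty (succ v)

data Player : Set where
  Even Odd : Player

opp : Player → Player
opp Even = Odd
opp Odd  = Even

_==P_ : Player → Player → Bool
Even ==P Even = true
Odd  ==P Odd  = true
_    ==P _    = false

module _ {n : ℕ} (G : Game n) where
  open Game G

  owner : Fin n → Player
  owner v = if (∣ prio v ∣ % 2) ≡ᵇ 0 then Even else Odd

  -- Subgames G[U] are represented by their vertex set U ⊆ Fin n;
  -- the neighbourhood of v in G[U] is  succ v ∩ U.

  sel : Subset n → (Fin n → Bool) → Subset n
  sel U f = tabulate (λ v → lookup U v ∧ f v)

  verticesOf : Player → Subset n → Subset n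
  verticesOf τ U = sel U (λ v → owner v ==P τ)

  IsTrap : Subset n → Player → Subset n → Set
  IsTrap U τ X =
    X ⊆ U ×
    (∀ v → v ∈ X → owner v ≡ τ → (succ v ∩ U) ⊆ X) ×
    (∀ v → v ∈ X → owner v ≡ opp τ → ∃ λ w → w ∈ (succ v ∩ U) × w ∈ X)

  MaxOwnedBy : Player → Subset n → Set
  MaxOwnedBy τ X = ∀ v → v ∈ X → (∀ w → w ∈ X → prio w ≤ℤ prio v) → owner v ≡ τ

  LegalMove : Player → Subset n → Subset n → Set
  LegalMove τ U X = Nonempty X × IsTrap U (opp τ) X × MaxOwnedBy τ X

  -- Wins σ k X : σ has just played X (so the current game is G[X] for
  -- the opponent's move) and σ can guarantee that the opponent has no
  -- legal move at some round within the next k rounds (the current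
  -- round counting as the first).
  Wins : Player → ℕ → Subset n → Set
  Wins σ zero    X = False
  Wins σ (suc k) X =
    ∀ Y → LegalMove (opp σ) X Y →
      ∃ λ X' → LegalMove σ Y X' × Wins σ k X'

  WinningFirstMove : Player → ℕ → Subset n → Set
  WinningFirstMove σ k X = LegalMove σ Full X × Wins σ k X

  -- Algorithms, as big-step (input/output) relations.

  IsLeast : (Subset n → Set) → Subset n → Set
  IsLeast P C = P C × (∀ D → P D → C ⊆ D)

  AttrClosed : Subset n → Player → Subset n → Set
  AttrClosed U τ C = ∀ v → v ∈ U →
    (owner v ≡ τ → (∃ λ w → w ∈ (succ v ∩ U) × w ∈ C) → v ∈ C) ×
    (owner v ≡ opp τ → (succ v ∩ U) ⊆ C → v ∈ C)

  IsAttr : Subset n → Subset n → Player → Subset n → Set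
  IsAttr U X τ = IsLeast (λ C → X ⊆ C × AttrClosed U τ C)

  SafeClosed : Subset n → ℤ → Player → Subset n → Set
  SafeClosed U l τ C = ∀ v → v ∈ U → prio v <ℤ l →
    (owner v ≡ τ → (∃ λ w → w ∈ (succ v ∩ U) × w ∈ C) → v ∈ C) ×
    (owner v ≡ opp τ → (succ v ∩ U) ⊆ C → v ∈ C)

  IsSafeAttr : Subset n → ℤ → Subset n → Player → Subset n → Set
  IsSafeAttr U l X τ = IsLeast (λ C → X ⊆ C × SafeClosed U l τ C)

  atLeast : Subset n → ℤ → Subset n
  atLeast U l = sel U (λ v → ⌊ l ≤ℤ? prio v ⌋)

  IsRestrict : Subset n → ℤ → Player → Subset n → Set
  IsRestrict U l τ R =
    ∃ λ A → IsAttr U (atLeast U l) (opp τ) A × R ≡ (U ─ A)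

  IsMaxPrio : Subset n → ℤ → Set
  IsMaxPrio W l = (∃ λ v → v ∈ W × prio v ≡ l) × (∀ v → v ∈ W → prio v ≤ℤ l)

  atPrio : Subset n → ℤ → Subset n
  atPrio W l = sel W (λ v → ⌊ prio v ≟ℤ l ⌋)

  module Algorithms (σ : Player)
                    (ParAlg : Subset n → Subset n → Set) where

    data GenLoop (U : Subset n) (l : ℤ) : Subset n → Subset n → Set where
      stop : ∀ {C S V' P} →
        IsSafeAttr U l C σ S →
        IsRestrict (U ─ S) l σ V' →
        ParAlg V' P →
        (S ∪ P) ≡ C →
        GenLoop U l C (S ∪ P)
      continue : ∀ {C S V' P out} →
        IsSafeAttr U l C σ S →
        IsRestrict (U ─ S) l σ V' →
        ParAlg V' P →
        (S ∪ P) ≢ C →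
        GenLoop U l (S ∪ P) out →
        GenLoop U l C out

    GenAttr : Subset n → ℤ → Subset n → Subset n → Set
    GenAttr U l X out = GenLoop U l X out

    data SeqLoop (U : Subset n) : Subset n → Subset n → Subset n → Set where
      done : ∀ {W C} → Empty W → SeqLoop U W C C
      step : ∀ {W C l C' out} →
        Nonempty W →
        IsMaxPrio W l →
        GenAttr U l (C ∪ atPrio W l) C' →
        SeqLoop U (W ─ C') C' out →
        SeqLoop U W C out

    SeqAttr : Subset n → Subset n → Subset n → Set
    SeqAttr U X out = SeqLoop U (verticesOf σ U ∩ X) ∅ out

    IsPruned : Subset n → Subset n → Subset n → Subset n → Set
    IsPruned U T C T' = ∀ v →
      (v ∈ T' → v ∈ T × ¬ (v ∈ verticesOf σ U × Empty (succ v ∩ U ∩ C))) ×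
      (v ∈ T → ¬ (v ∈ verticesOf σ U × Empty (succ v ∩ U ∩ C)) → v ∈ T')

    data TDALoop (U : Subset n) : Subset n → Subset n → Set where
      stop : ∀ {T C T'} →
        SeqAttr U T C → IsPruned U T C T' → T' ≡ T → TDALoop U T C
      continue : ∀ {T C T' out} →
        SeqAttr U T C → IsPruned U T C T' → T' ≢ T →
        TDALoop U T' out → TDALoop U T out

    TDA : Subset n → Subset n → Set
    TDA U out = TDALoop U (verticesOf σ U) out

  TDAk : Player → ℕ → Subset n → Subset n → Set
  TDAk σ zero    U out = out ≡ ∅
  TDAk σ (suc k) U out = Algorithms.TDA σ (TDAk σ k) U out

module Submission where

-- Induction on k; for k = 0 nobody wins within 0 rounds and TDA_0 returns ∅. For the step, TDA_k is
-- assumed correct on every subgame G[V].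
--
-- Soundness: the partial results C of TDA satisfy an invariant (relative to the final output F): the
-- opponent's vertices in C cannot leave C, σ's vertices in C are still targets or can stay in C, and
-- every opponent move in G[F] that meets C has a winning reply. Safe attractors preserve it because the
-- opponent's move is a σ-trap; adding the answer P of TDA_k on the restricted game preserves it because
-- a move meeting P but not the attractor yields a subgame of P, on which P wins within k rounds. When
-- the target set T is stable, every σ-vertex of F has a successor in F, so F is a winning first move.
--
-- Completeness: let X be a winning first move. After each GenAttr stage at priority λ, the uncollected
-- part R of X lies below λ and has a σ-owned top: otherwise the opponent could play R, and σ's winning
-- reply would be a legal move of the restricted game, hence inside the answer of TDA_k and collected.
-- So SeqAttr collects all of X, and pruning never removes a σ-vertex of X.
--
-- Termination: each loop strictly grows, or strictly shrinks, a subset of a finite set.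

open import Defs
open import Data.Bool using (Bool; true; _∧_; if_then_else_)
open import Data.Bool.Properties using () renaming (_≟_ to _≟ᵇ_)
open import Data.Empty using (⊥; ⊥-elim)
open import Data.Fin using (Fin; zero; suc)
open import Data.Fin.Properties using (any?)
open import Data.Fin.Subset
  using (Subset; _∈_; _∉_; _⊆_; _⊂_; _⊃_; _∩_; _∪_; _─_; Nonempty; Empty; inside; outside)
  renaming (⊤ to Full; ⊥ to ∅)
open import Data.Fin.Subset.Induction using (⊂-wellFounded; ⊃-wellFounded)
open import Data.Fin.Subset.Properties
  using (x∈p∩q⁺; x∈p∩q⁻; x∈p∪q⁺; x∈p∪q⁻; x∈p∧x∉q⇒x∈p─q; p─q⊆p; ∉⊥; ⊆-antisym;
         _∈?_; _⊆?_; nonempty?; p∩q≢∅⇒p─q⊂p)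
open import Data.Integer using (ℤ; ∣_∣)
  renaming (_≤_ to _≤ℤ_; _<_ to _<ℤ_; _<?_ to _<ℤ?_; _≤?_ to _≤ℤ?_; _≟_ to _≟ℤ_)
import Data.Integer.Properties as ℤ
open import Data.Nat using (ℕ; zero; suc; _%_; _≡ᵇ_)
open import Data.Product using (∃; _×_; _,_; proj₁; proj₂)
open import Data.Sum using (_⊎_; inj₁; inj₂; [_,_]′)
open import Data.Unit using (tt)
open import Data.Vec using (_∷_; lookup; tabulate; here; there)
open import Data.Vec.Properties using (lookup∘tabulate; []=⇒lookup; lookup⇒[]=; ≡-dec)
open import Function using (_∘_; id)
open import Induction.WellFounded using (Acc; acc)
open import Relation.Binary.PropositionalEquality
  using (_≡_; _≢_; refl; sym; trans; cong; subst)
open import Relation.Nullary using (¬_; Dec; yes; no)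
open import Relation.Nullary.Decidable using (⌊_⌋; _×-dec_; _⊎-dec_; ¬?; decidable-stable)

module _ {n : ℕ} {p q : Subset n} {x : Fin n} where
  ∈∩⁺ : x ∈ p → x ∈ q → x ∈ p ∩ q
  ∈∩⁺ x∈p x∈q = x∈p∩q⁺ (x∈p , x∈q)

  ∈∩⁻ˡ : x ∈ p ∩ q → x ∈ p
  ∈∩⁻ˡ = proj₁ ∘ x∈p∩q⁻ p q

  ∈∩⁻ʳ : x ∈ p ∩ q → x ∈ q
  ∈∩⁻ʳ = proj₂ ∘ x∈p∩q⁻ p q

  ∈∪ˡ : x ∈ p → x ∈ p ∪ q
  ∈∪ˡ = x∈p∪q⁺ ∘ inj₁

  ∈∪ʳ : x ∈ q → x ∈ p ∪ q
  ∈∪ʳ = x∈p∪q⁺ ∘ inj₂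

  ∈∪⁻ : x ∈ p ∪ q → x ∈ p ⊎ x ∈ q
  ∈∪⁻ = x∈p∪q⁻ p q

  ∈─⁺ : x ∈ p → x ∉ q → x ∈ p ─ q
  ∈─⁺ = x∈p∧x∉q⇒x∈p─q

  ∈─⁻ˡ : x ∈ p ─ q → x ∈ p
  ∈─⁻ˡ = p─q⊆p p q

∈─⁻ʳ : ∀ {n} {p q : Subset n} {x} → x ∈ p ─ q → x ∉ q
∈─⁻ʳ {p = _ ∷ _} {outside ∷ _} here       ()
∈─⁻ʳ {p = _ ∷ _} {_ ∷ _}       (there x∈) (there x∈q) = ∈─⁻ʳ x∈ x∈q

module _ {n : ℕ} where
  ⊈⇒∃∉ : {p q : Subset n} → ¬ p ⊆ q → ∃ λ x → x ∈ p × x ∉ q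
  ⊈⇒∃∉ {p} {q} p⊈q with any? (λ x → (x ∈? p) ×-dec ¬? (x ∈? q))
  ... | yes witness = witness
  ... | no none = ⊥-elim (p⊈q λ {x} x∈p →
          decidable-stable (x ∈? q) (λ x∉q → none (x , x∈p , x∉q)))

  ⊆∧≢⇒⊂ : {p q : Subset n} → p ⊆ q → p ≢ q → p ⊂ q
  ⊆∧≢⇒⊂ p⊆q p≢q = p⊆q , ⊈⇒∃∉ (p≢q ∘ ⊆-antisym p⊆q)

  ¬Empty⇒Nonempty : {p : Subset n} → ¬ Empty p → Nonempty p
  ¬Empty⇒Nonempty {p} = decidable-stable (nonempty? p)

  ∈tabulate⁺ : (f : Fin n → Bool) {x : Fin n} → f x ≡ true → x ∈ tabulate f
  ∈tabulate⁺ f {x} fx = lookup⇒[]= x (tabulate f) (trans (lookup∘tabulate f x) fx)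

  ∈tabulate⁻ : (f : Fin n → Bool) {x : Fin n} → x ∈ tabulate f → f x ≡ true
  ∈tabulate⁻ f {x} x∈ = trans (sym (lookup∘tabulate f x)) ([]=⇒lookup x∈)

isYes⁺ : ∀ {P : Set} (P? : Dec P) → P → ⌊ P? ⌋ ≡ true
isYes⁺ (yes _) _ = refl
isYes⁺ (no ¬p) p = ⊥-elim (¬p p)

isYes⁻ : ∀ {P : Set} (P? : Dec P) → ⌊ P? ⌋ ≡ true → P
isYes⁻ (yes p) _ = p

module _ {n : ℕ} {P : Fin n → Set} (P? : ∀ x → Dec (P x)) where
  decSubset : Subset n
  decSubset = tabulate (λ x → ⌊ P? x ⌋)

  ∈decSubset⁺ : ∀ {x} → P x → x ∈ decSubset
  ∈decSubset⁺ {x} = ∈tabulate⁺ _ ∘ isYes⁺ (P? x)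

  ∈decSubset⁻ : ∀ {x} → x ∈ decSubset → P x
  ∈decSubset⁻ {x} = isYes⁻ (P? x) ∘ ∈tabulate⁻ _

IsArgmax : ∀ {n} → (Fin n → ℤ) → Subset n → Fin n → Set
IsArgmax f W m = m ∈ W × (∀ w → w ∈ W → f w ≤ℤ f m)

argmax : ∀ {n} (f : Fin n → ℤ) (W : Subset n) → Nonempty W → ∃ (IsArgmax f W)
argmax f (b ∷ W) ne with nonempty? W
argmax f (inside ∷ W) ne | no W-empty =
  zero , here , λ { zero here → ℤ.≤-refl ; (suc w) (there w∈W) → ⊥-elim (W-empty (w , w∈W)) }
argmax f (outside ∷ W) (suc x , there x∈W) | no W-empty = ⊥-elim (W-empty (x , x∈W))
argmax f (b ∷ W) ne | yes W-ne with argmax (f ∘ suc) W W-ne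
argmax f (outside ∷ W) ne | yes _ | m , m∈W , m-max =
  suc m , there m∈W , λ { (suc w) (there w∈W) → m-max w w∈W }
argmax f (inside ∷ W) ne | yes _ | m , m∈W , m-max with ℤ.≤-total (f zero) (f (suc m))
... | inj₁ f0≤fm = suc m , there m∈W , λ { zero here → f0≤fm ; (suc w) (there w∈W) → m-max w w∈W }
... | inj₂ fm≤f0 = zero , here ,
      λ { zero here → ℤ.≤-refl ; (suc w) (there w∈W) → ℤ.≤-trans (m-max w w∈W) fm≤f0 }

module LeastClosed {n : ℕ} (F : Subset n → Fin n → Set) where
  Closed : Subset n → Set
  Closed D = ∀ {v} → F D v → v ∈ D

  IsLeastClosed : Subset n → Subset n → Set
  IsLeastClosed X C = (X ⊆ C × Closed C) × (∀ D → X ⊆ D × Closed D → C ⊆ D)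

  module _ (F? : ∀ C v → Dec (F C v)) (F-mono : ∀ {C D} → C ⊆ D → ∀ {v} → F C v → F D v) where
    leastClosed-exists : ∀ X → ∃ (IsLeastClosed X)
    leastClosed-exists X = iterate X (⊃-wellFounded X) id (λ _ → proj₁)
      where
      grow : Subset n → Subset n
      grow C = C ∪ decSubset (F? C)

      iterate : ∀ C → Acc _⊃_ C → X ⊆ C → (∀ D → X ⊆ D × Closed D → C ⊆ D) → ∃ (IsLeastClosed X)
      iterate C (acc larger) X⊆C C-below with ≡-dec _≟ᵇ_ (grow C) C
      ... | yes fixed = C , (X⊆C , λ Fv → subst (_ ∈_) fixed (∈∪ʳ (∈decSubset⁺ (F? C) Fv))) , C-below
      ... | no grew = iterate (grow C) (larger (⊆∧≢⇒⊂ ∈∪ˡ (grew ∘ sym))) (∈∪ˡ ∘ X⊆C) grow-below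
        where
        grow-below : ∀ D → X ⊆ D × Closed D → grow C ⊆ D
        grow-below D D-closed v∈ with ∈∪⁻ v∈
        ... | inj₁ v∈C = C-below D D-closed v∈C
        ... | inj₂ v∈F = proj₂ D-closed (F-mono (C-below D D-closed) (∈decSubset⁻ (F? C) v∈F))

    leastClosed-inversion : ∀ {X C} → IsLeastClosed X C → ∀ {v} → v ∈ C → v ∈ X ⊎ F C v
    leastClosed-inversion {X} {C} ((X⊆C , C-closed) , C-least) v∈C =
      ∈decSubset⁻ X-or-fired? (C-least D (∈decSubset⁺ X-or-fired? ∘ inj₁ , D-closed) v∈C)
      where
      X-or-fired? : ∀ v → Dec (v ∈ X ⊎ F C v)
      X-or-fired? v = (v ∈? X) ⊎-dec F? C v
      D : Subset n
      D = decSubset X-or-fired?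
      D⊆C : D ⊆ C
      D⊆C = [ X⊆C , C-closed ]′ ∘ ∈decSubset⁻ X-or-fired?
      D-closed : Closed D
      D-closed = ∈decSubset⁺ X-or-fired? ∘ inj₂ ∘ F-mono D⊆C

opp-involutive : ∀ τ → opp (opp τ) ≡ τ
opp-involutive Even = refl
opp-involutive Odd  = refl

≡-or-≡opp : ∀ τ ρ → ρ ≡ τ ⊎ ρ ≡ opp τ
≡-or-≡opp Even Even = inj₁ refl
≡-or-≡opp Even Odd  = inj₂ refl
≡-or-≡opp Odd  Even = inj₂ refl
≡-or-≡opp Odd  Odd  = inj₁ refl

≡∧≡opp⇒⊥ : ∀ {ρ τ} → ρ ≡ τ → ρ ≡ opp τ → ⊥
≡∧≡opp⇒⊥ {τ = Even} refl ()
≡∧≡opp⇒⊥ {τ = Odd}  refl ()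

≡opp²⇒≡ : ∀ {ρ τ} → ρ ≡ opp (opp τ) → ρ ≡ τ
≡opp²⇒≡ {τ = τ} ρ≡ = trans ρ≡ (opp-involutive τ)

≡⇒≡opp² : ∀ {ρ τ} → ρ ≡ τ → ρ ≡ opp (opp τ)
≡⇒≡opp² {τ = τ} ρ≡ = trans ρ≡ (sym (opp-involutive τ))

==P⇒≡ : ∀ ρ τ → (ρ ==P τ) ≡ true → ρ ≡ τ
==P⇒≡ Even Even _ = refl
==P⇒≡ Odd  Odd  _ = refl

==P-refl : ∀ ρ → (ρ ==P ρ) ≡ true
==P-refl Even = refl
==P-refl Odd  = refl

_≟P_ : (ρ τ : Player) → Dec (ρ ≡ τ)
Even ≟P Even = yes refl
Odd  ≟P Odd  = yes refl
Even ≟P Odd  = no λ ()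
Odd  ≟P Even = no λ ()

module GameFacts {n : ℕ} (G : Game n) where
  open Game G

  owner-cong : ∀ {v w} → prio v ≡ prio w → owner G v ≡ owner G w
  owner-cong = cong (λ z → if (∣ z ∣ % 2) ≡ᵇ 0 then Even else Odd)

  ∈sel⁺ : ∀ U f {x} → x ∈ U → f x ≡ true → x ∈ sel G U f
  ∈sel⁺ U f {x} x∈U fx = ∈tabulate⁺ _ (trans (cong (_∧ f x) ([]=⇒lookup x∈U)) fx)

  ∈sel⁻ : ∀ U f {x} → x ∈ sel G U f → x ∈ U × f x ≡ true
  ∈sel⁻ U f {x} x∈ with lookup U x in eq | ∈tabulate⁻ (λ v → lookup U v ∧ f v) x∈
  ... | true | fx = lookup⇒[]= x U eq , fx

  ∈verticesOf⁺ : ∀ {τ U x} → x ∈ U → owner G x ≡ τ → x ∈ verticesOf G τ U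
  ∈verticesOf⁺ {U = U} {x} x∈U refl = ∈sel⁺ U _ x∈U (==P-refl (owner G x))

  ∈verticesOf⁻ : ∀ {τ} U {x} → x ∈ verticesOf G τ U → x ∈ U × owner G x ≡ τ
  ∈verticesOf⁻ {τ} U {x} x∈ with ∈sel⁻ U _ x∈
  ... | x∈U , owned = x∈U , ==P⇒≡ (owner G x) τ owned

  ∈atLeast⁺ : ∀ {U l x} → x ∈ U → l ≤ℤ prio x → x ∈ atLeast G U l
  ∈atLeast⁺ {U} {l} {x} x∈U l≤x = ∈sel⁺ U _ x∈U (isYes⁺ (l ≤ℤ? prio x) l≤x)

  ∈atLeast⁻ : ∀ U {l x} → x ∈ atLeast G U l → x ∈ U × l ≤ℤ prio x
  ∈atLeast⁻ U {l} {x} x∈ with ∈sel⁻ U _ x∈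
  ... | x∈U , l≤x = x∈U , isYes⁻ (l ≤ℤ? prio x) l≤x

  ∈atPrio⁺ : ∀ {U l x} → x ∈ U → prio x ≡ l → x ∈ atPrio G U l
  ∈atPrio⁺ {U} {l} {x} x∈U x≡l = ∈sel⁺ U _ x∈U (isYes⁺ (prio x ≟ℤ l) x≡l)

  ∈atPrio⁻ : ∀ U {l x} → x ∈ atPrio G U l → x ∈ U × prio x ≡ l
  ∈atPrio⁻ U {l} {x} x∈ with ∈sel⁻ U _ x∈
  ... | x∈U , x≡l = x∈U , isYes⁻ (prio x ≟ℤ l) x≡l

  trap-trans : ∀ {U X Y τ} → IsTrap G U τ X → IsTrap G X τ Y → IsTrap G U τ Y
  trap-trans (X⊆U , X-closed , X-escape) (Y⊆X , Y-closed , Y-escape) =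
    X⊆U ∘ Y⊆X ,
    (λ v v∈Y v-τ w∈N∩U → Y-closed v v∈Y v-τ (∈∩⁺ (∈∩⁻ˡ w∈N∩U) (X-closed v (Y⊆X v∈Y) v-τ w∈N∩U))) ,
    (λ v v∈Y v-opp → let (w , w∈N∩X , w∈Y) = Y-escape v v∈Y v-opp in
                     w , ∈∩⁺ (∈∩⁻ˡ w∈N∩X) (X⊆U (∈∩⁻ʳ w∈N∩X)) , w∈Y)

  opp²-trap : ∀ {U X τ} → IsTrap G U (opp (opp τ)) X → IsTrap G U τ X
  opp²-trap {U} {X} {τ} = subst (λ ρ → IsTrap G U ρ X) (opp-involutive τ)

  IsSubgame : Subset n → Set
  IsSubgame Z = ∀ v → v ∈ Z → ∃ λ w → w ∈ succ v × w ∈ Z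

  subgame⇒trap : ∀ {U Z} τ → IsSubgame Z → Z ⊆ U →
                 (∀ v → v ∈ Z → owner G v ≡ τ → succ v ∩ U ⊆ Z) → IsTrap G U τ Z
  subgame⇒trap τ Z-subgame Z⊆U Z-closed =
    Z⊆U , Z-closed ,
    λ v v∈Z _ → let (w , w∈N , w∈Z) = Z-subgame v v∈Z in w , ∈∩⁺ w∈N (Z⊆U w∈Z) , w∈Z

  argmax⇒maxOwnedBy : ∀ τ {X m} → IsArgmax prio X m → owner G m ≡ τ → MaxOwnedBy G τ X
  argmax⇒maxOwnedBy τ (m∈X , m-max) m-τ v v∈X v-max =
    trans (owner-cong (ℤ.≤-antisym (m-max v v∈X) (v-max _ m∈X))) m-τ

  maxOwnedBy⇒argmax : ∀ τ {X} → Nonempty X → MaxOwnedBy G τ X →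
                      ∃ λ m → IsArgmax prio X m × owner G m ≡ τ
  maxOwnedBy⇒argmax τ {X} ne X-max with argmax prio X ne
  ... | m , m∈X , m-max = m , (m∈X , m-max) , X-max m m∈X m-max

module Attractors {n : ℕ} (G : Game n) where
  open Game G

  Attracts : Subset n → Player → Subset n → Fin n → Set
  Attracts U τ C v =
    (owner G v ≡ τ → (∃ λ w → w ∈ succ v ∩ U × w ∈ C) → v ∈ C) ×
    (owner G v ≡ opp τ → succ v ∩ U ⊆ C → v ∈ C)

  -- g guards which vertices may be attracted: a priority bound for SafeAttr, none for Attr
  GuardedAttr : Subset n → (Fin n → Set) → Player → Subset n → Subset n → Set
  GuardedAttr U g τ X = IsLeast G (λ C → X ⊆ C × ∀ v → v ∈ U → g v → Attracts U τ C v)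

  Fires : Subset n → (Fin n → Set) → Player → Subset n → Fin n → Set
  Fires U g τ C v = v ∈ U × g v ×
    ((owner G v ≡ τ × ∃ λ w → w ∈ succ v ∩ U × w ∈ C) ⊎ (owner G v ≡ opp τ × succ v ∩ U ⊆ C))

  fires? : ∀ U {g} → (∀ v → Dec (g v)) → ∀ τ C v → Dec (Fires U g τ C v)
  fires? U g? τ C v = (v ∈? U) ×-dec g? v ×-dec
    ((owner G v ≟P τ) ×-dec any? (λ w → (w ∈? succ v ∩ U) ×-dec (w ∈? C)) ⊎-dec
     (owner G v ≟P opp τ) ×-dec (succ v ∩ U ⊆? C))

  fires-mono : ∀ {U g τ C D} → C ⊆ D → ∀ {v} → Fires U g τ C v → Fires U g τ D v
  fires-mono C⊆D (v∈U , gv , inj₁ (v-τ , w , w∈N , w∈C)) = v∈U , gv , inj₁ (v-τ , w , w∈N , C⊆D w∈C)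
  fires-mono C⊆D (v∈U , gv , inj₂ (v-opp , N⊆C))         = v∈U , gv , inj₂ (v-opp , C⊆D ∘ N⊆C)

  module _ {U : Subset n} {g : Fin n → Set} {τ : Player} where
    open LeastClosed (Fires U g τ)

    attracts⇒closed : ∀ {D} → (∀ v → v ∈ U → g v → Attracts U τ D v) → Closed D
    attracts⇒closed D-att (v∈U , gv , inj₁ (v-τ , escape)) = proj₁ (D-att _ v∈U gv) v-τ escape
    attracts⇒closed D-att (v∈U , gv , inj₂ (v-opp , N⊆D))  = proj₂ (D-att _ v∈U gv) v-opp N⊆D

    closed⇒attracts : ∀ {D} → Closed D → ∀ v → v ∈ U → g v → Attracts U τ D v
    closed⇒attracts D-closed v v∈U gv =
      (λ v-τ escape → D-closed (v∈U , gv , inj₁ (v-τ , escape))) ,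
      (λ v-opp N⊆D → D-closed (v∈U , gv , inj₂ (v-opp , N⊆D)))

    guardedAttr⇒leastClosed : ∀ {X C} → GuardedAttr U g τ X C → IsLeastClosed X C
    guardedAttr⇒leastClosed ((X⊆C , C-att) , C-least) =
      (X⊆C , attracts⇒closed C-att) ,
      λ D (X⊆D , D-closed) → C-least D (X⊆D , closed⇒attracts D-closed)

    leastClosed⇒guardedAttr : ∀ {X C} → IsLeastClosed X C → GuardedAttr U g τ X C
    leastClosed⇒guardedAttr ((X⊆C , C-closed) , C-least) =
      (X⊆C , closed⇒attracts C-closed) ,
      λ D (X⊆D , D-att) → C-least D (X⊆D , attracts⇒closed D-att)

    module _ (g? : ∀ v → Dec (g v)) where
      guardedAttr-exists : ∀ X → ∃ (GuardedAttr U g τ X)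
      guardedAttr-exists X with leastClosed-exists (fires? U g? τ) fires-mono X
      ... | C , C-least = C , leastClosed⇒guardedAttr C-least

      guardedAttr-inversion : ∀ {X C} → GuardedAttr U g τ X C →
                              ∀ {v} → v ∈ C → v ∈ X ⊎ Fires U g τ C v
      guardedAttr-inversion =
        leastClosed-inversion (fires? U g? τ) fires-mono ∘ guardedAttr⇒leastClosed

  attr-exists : ∀ U X τ → ∃ (IsAttr G U X τ)
  attr-exists U X τ with guardedAttr-exists {U} {τ = τ} (λ _ → yes tt) X
  ... | A , (X⊆A , A-att) , A-least =
    A , (X⊆A , λ v v∈U → A-att v v∈U tt) , λ D (X⊆D , D-att) → A-least D (X⊆D , λ v v∈U _ → D-att v v∈U)

  safeAttr-exists : ∀ U l X τ → ∃ (IsSafeAttr G U l X τ)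
  safeAttr-exists U l X τ = guardedAttr-exists {U} {τ = τ} (λ v → prio v <ℤ? l) X

  safeAttr-inversion : ∀ {U l X τ S} → IsSafeAttr G U l X τ S →
                       ∀ {v} → v ∈ S → v ∈ X ⊎ Fires U (λ v → prio v <ℤ l) τ S v
  safeAttr-inversion {l = l} = guardedAttr-inversion (λ v → prio v <ℤ? l)

  -- no vertex of the τ-trap Y is ever attracted (τ cannot leave Y, the opponent can stay in it),
  -- so the attractor meets Y only inside its target
  safeAttr-meets-trap : ∀ {U F l X τ S Y} → IsSafeAttr G U l X τ S → S ⊆ F → F ⊆ U →
                        IsTrap G F τ Y → Nonempty (Y ∩ S) → Nonempty (Y ∩ X)
  safeAttr-meets-trap {U} {F} {l} {X} {τ} {S} {Y}
                      ((X⊆S , S-att) , S-least) S⊆F F⊆U (_ , Y-closed , Y-escape) (y , y∈Y∩S)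
    with nonempty? (Y ∩ X)
  ... | yes meets = meets
  ... | no misses =
    ⊥-elim (∈─⁻ʳ (S-least (S ─ Y) (X⊆S─Y , S─Y-att) (∈∩⁻ʳ y∈Y∩S)) (∈∩⁻ˡ y∈Y∩S))
    where
    X⊆S─Y : X ⊆ S ─ Y
    X⊆S─Y x∈X = ∈─⁺ (X⊆S x∈X) (λ x∈Y → misses (_ , ∈∩⁺ x∈Y x∈X))
    S─Y-att : ∀ v → v ∈ U → prio v <ℤ l → Attracts U τ (S ─ Y) v
    S─Y-att v v∈U v<l =
      (λ v-τ (w , w∈N∩U , w∈S─Y) →
         ∈─⁺ (proj₁ (S-att v v∈U v<l) v-τ (w , w∈N∩U , ∈─⁻ˡ w∈S─Y))
             (λ v∈Y → ∈─⁻ʳ w∈S─Y (Y-closed v v∈Y v-τ (∈∩⁺ (∈∩⁻ˡ w∈N∩U) (S⊆F (∈─⁻ˡ w∈S─Y)))))) ,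
      (λ v-opp N⊆S─Y →
         ∈─⁺ (proj₂ (S-att v v∈U v<l) v-opp (∈─⁻ˡ ∘ N⊆S─Y))
             (λ v∈Y → let (w , w∈N∩F , w∈Y) = Y-escape v v∈Y v-opp in
                      ∈─⁻ʳ (N⊆S─Y (∈∩⁺ (∈∩⁻ˡ w∈N∩F) (F⊆U (∈∩⁻ʳ w∈N∩F)))) w∈Y))

module TrapDepth {n : ℕ} (G : Game n) (σ : Player) where
  open Game G
  open GameFacts G

  HasWinningReply : ℕ → Subset n → Set
  HasWinningReply k Y = ∃ λ X → LegalMove G σ Y X × Wins G σ k X

  wins-suc : ∀ k {X} → Wins G σ k X → Wins G σ (suc k) X
  wins-suc (suc k) X-wins Y Y-legal with X-wins Y Y-legal
  ... | X' , X'-legal , X'-wins = X' , X'-legal , wins-suc k X'-wins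

  wins-subtrap : ∀ k {X Z} → Wins G σ k X → IsTrap G X (opp (opp σ)) Z → Wins G σ k Z
  wins-subtrap (suc k) X-wins Z-trap Y (ne , Y-trap , Y-max) =
    X-wins Y (ne , trap-trans Z-trap Y-trap , Y-max)

  reply-lift : ∀ k {Y Z} → IsTrap G Y (opp σ) Z → HasWinningReply k Z → HasWinningReply k Y
  reply-lift k Z-trap (X , (ne , X-trap , X-max) , X-wins) =
    X , (ne , trap-trans Z-trap X-trap , X-max) , X-wins

  -- σ plays Z itself if its top is σ's; otherwise the opponent may play Z, and σ replies
  subgame-reply : ∀ k {Z} → IsSubgame Z → Nonempty Z → Wins G σ k Z → HasWinningReply k Z
  subgame-reply (suc k) {Z} Z-subgame ne Z-wins with argmax prio Z ne
  ... | m , m-max with ≡-or-≡opp σ (owner G m)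
  ... | inj₁ m-σ = Z , (ne , subgame⇒trap _ Z-subgame id (λ _ _ _ → ∈∩⁻ʳ) , argmax⇒maxOwnedBy σ m-max m-σ) , Z-wins
  ... | inj₂ m-opp
    with Z-wins Z (ne , subgame⇒trap _ Z-subgame id (λ _ _ _ → ∈∩⁻ʳ) , argmax⇒maxOwnedBy (opp σ) m-max m-opp)
  ...   | X , X-legal , X-wins = X , X-legal , wins-suc k X-wins

  record Correct (Alg : Subset n → Subset n → Set) (k : ℕ) : Set where
    field
      exists   : ∀ U → ∃ (Alg U)
      sound    : ∀ {U P} → Alg U P → Nonempty P → LegalMove G σ U P × Wins G σ k P
      complete : ∀ {U P} → Alg U P → ∀ {X} → LegalMove G σ U X → Wins G σ k X → X ⊆ P

module TDAStep {n : ℕ} (G : Game n) (σ : Player) (ParAlg : Subset n → Subset n → Set) {k : ℕ}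
               (IH : TrapDepth.Correct G σ ParAlg k) where
  open Game G
  open GameFacts G
  open Attractors G
  open TrapDepth G σ
  open Algorithms G σ ParAlg
  open Correct IH renaming (exists to answer-exists; sound to answer-sound; complete to answer-complete)

  module Answer {V P} (P-out : ParAlg V P) where
    legal : ∀ {v} → v ∈ P → LegalMove G σ V P
    legal v∈P = proj₁ (answer-sound P-out (_ , v∈P))

    wins : ∀ {v} → v ∈ P → Wins G σ k P
    wins v∈P = proj₂ (answer-sound P-out (_ , v∈P))

    ⊆V : P ⊆ V
    ⊆V v∈P = proj₁ (proj₁ (proj₂ (legal v∈P))) v∈P

    opp-closed : ∀ {v} → v ∈ P → owner G v ≡ opp σ → succ v ∩ V ⊆ P
    opp-closed v∈P = proj₁ (proj₂ (proj₁ (proj₂ (legal v∈P)))) _ v∈P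

    σ-escape : ∀ {v} → v ∈ P → owner G v ≡ σ → ∃ λ w → w ∈ succ v ∩ V × w ∈ P
    σ-escape v∈P v-σ = proj₂ (proj₂ (proj₁ (proj₂ (legal v∈P)))) _ v∈P (≡⇒≡opp² v-σ)

  module Restricted {U S l V'} (r : IsRestrict G (U ─ S) l σ V') where
    A : Subset n
    A = proj₁ r

    atLeast⊆A : atLeast G (U ─ S) l ⊆ A
    atLeast⊆A = proj₁ (proj₁ (proj₁ (proj₂ r)))

    A-att : AttrClosed G (U ─ S) (opp σ) A
    A-att = proj₂ (proj₁ (proj₁ (proj₂ r)))

    A-least : ∀ D → atLeast G (U ─ S) l ⊆ D × AttrClosed G (U ─ S) (opp σ) D → A ⊆ D
    A-least = proj₂ (proj₁ (proj₂ r))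

    ∈V'⁺ : ∀ {v} → v ∈ U → v ∉ S → v ∉ A → v ∈ V'
    ∈V'⁺ v∈U v∉S v∉A = subst (_ ∈_) (sym (proj₂ (proj₂ r))) (∈─⁺ (∈─⁺ v∈U v∉S) v∉A)

    ∈V'⁻ : ∀ {v} → v ∈ V' → v ∈ U × v ∉ S × v ∉ A
    ∈V'⁻ v∈V' = let v∈ = subst (_ ∈_) (proj₂ (proj₂ r)) v∈V' in
                ∈─⁻ˡ (∈─⁻ˡ v∈) , ∈─⁻ʳ (∈─⁻ˡ v∈) , ∈─⁻ʳ v∈

    V'-below : ∀ {v} → v ∈ V' → prio v <ℤ l
    V'-below {v} v∈V' with l ≤ℤ? prio v | ∈V'⁻ v∈V'
    ... | no  l≰v | _ = ℤ.≰⇒> l≰v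
    ... | yes l≤v | v∈U , v∉S , v∉A = ⊥-elim (v∉A (atLeast⊆A (∈atLeast⁺ (∈─⁺ v∈U v∉S) l≤v)))

    opp-successor : ∀ {v} → v ∈ V' → owner G v ≡ opp σ →
                    ∀ {w} → w ∈ succ v → w ∈ U → w ∈ S ⊎ w ∈ V'
    opp-successor {v} v∈V' v-opp {w} w∈N w∈U with w ∈? S | w ∈? A | ∈V'⁻ v∈V'
    ... | yes w∈S | _       | _ = inj₁ w∈S
    ... | no  w∉S | no  w∉A | _ = inj₂ (∈V'⁺ w∈U w∉S w∉A)
    ... | no  w∉S | yes w∈A | v∈U , v∉S , v∉A =
      ⊥-elim (v∉A (proj₁ (A-att v (∈─⁺ v∈U v∉S)) v-opp (w , ∈∩⁺ w∈N (∈─⁺ w∈U w∉S) , w∈A)))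

  safeAttr-⊇ : ∀ {U l C S} → IsSafeAttr G U l C σ S → C ⊆ S
  safeAttr-⊇ = proj₁ ∘ proj₁

  genAttr-⊇ : ∀ {U l C out} → GenLoop U l C out → C ⊆ out
  genAttr-⊇ (stop S-attr _ _ _)          = ∈∪ˡ ∘ safeAttr-⊇ S-attr
  genAttr-⊇ (continue S-attr _ _ _ loop) = genAttr-⊇ loop ∘ ∈∪ˡ ∘ safeAttr-⊇ S-attr

  seqAttr-⊇ : ∀ {U W C out} → SeqLoop U W C out → C ⊆ out
  seqAttr-⊇ (done _)            = id
  seqAttr-⊇ (step _ _ gen loop) = seqAttr-⊇ loop ∘ genAttr-⊇ gen ∘ ∈∪ˡ

  genAttr-exists : ∀ U l C → ∃ (GenLoop U l C)
  genAttr-exists U l C = iterate C (⊃-wellFounded C)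
    where
    iterate : ∀ C → Acc _⊃_ C → ∃ (GenLoop U l C)
    iterate C (acc larger) with safeAttr-exists U l C σ
    ... | S , S-attr with attr-exists (U ─ S) (atLeast G (U ─ S) l) (opp σ)
    ... | A , A-attr with answer-exists (U ─ S ─ A)
    ... | P , P-out with ≡-dec _≟ᵇ_ (S ∪ P) C
    ... | yes fixed = S ∪ P , stop S-attr (A , A-attr , refl) P-out fixed
    ... | no grew with iterate (S ∪ P) (larger (⊆∧≢⇒⊂ (∈∪ˡ ∘ safeAttr-⊇ S-attr) (grew ∘ sym)))
    ...   | out , loop = out , continue S-attr (A , A-attr , refl) P-out grew loop

  seqAttr-exists : ∀ U W C → ∃ (SeqLoop U W C)
  seqAttr-exists U W C = iterate W C (⊂-wellFounded W)
    where
    iterate : ∀ W C → Acc _⊂_ W → ∃ (SeqLoop U W C)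
    iterate W C (acc smaller) with nonempty? W
    ... | no W-empty = C , done W-empty
    ... | yes W-ne with argmax prio W W-ne
    ... | m , m∈W , m-max with genAttr-exists U (prio m) (C ∪ atPrio G W (prio m))
    ... | C' , gen with iterate (W ─ C') C'
                          (smaller (p∩q≢∅⇒p─q⊂p W C'
                            (m , ∈∩⁺ m∈W (genAttr-⊇ gen (∈∪ʳ (∈atPrio⁺ m∈W refl))))))
    ...   | out , loop = out , step W-ne ((m , m∈W , refl) , m-max) gen loop

  Kept : Subset n → Subset n → Subset n → Fin n → Set
  Kept U T C v = v ∈ T × ¬ (v ∈ verticesOf G σ U × Empty (succ v ∩ U ∩ C))

  kept? : ∀ U T C v → Dec (Kept U T C v)
  kept? U T C v =
    (v ∈? T) ×-dec ¬? ((v ∈? verticesOf G σ U) ×-dec ¬? (nonempty? (succ v ∩ U ∩ C)))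

  pruned : ∀ U T C → IsPruned U T C (decSubset (kept? U T C))
  pruned U T C v = ∈decSubset⁻ (kept? U T C) , λ v∈T keep → ∈decSubset⁺ (kept? U T C) (v∈T , keep)

  tda-exists : ∀ U → ∃ (TDA U)
  tda-exists U = iterate (verticesOf G σ U) (⊂-wellFounded _)
    where
    iterate : ∀ T → Acc _⊂_ T → ∃ (TDALoop U T)
    iterate T (acc smaller) with seqAttr-exists U (verticesOf G σ U ∩ T) ∅
    ... | C , seq with ≡-dec _≟ᵇ_ (decSubset (kept? U T C)) T
    ... | yes fixed = C , stop seq (pruned U T C) fixed
    ... | no shrank with iterate _ (smaller (⊆∧≢⇒⊂ (proj₁ ∘ ∈decSubset⁻ (kept? U T C)) shrank))
    ...   | out , loop = out , continue seq (pruned U T C) shrank loop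

  iteration-⊆ : ∀ {U l C S V' P} → IsSafeAttr G U l C σ S → IsRestrict G (U ─ S) l σ V' →
                ParAlg V' P → C ⊆ U → S ∪ P ⊆ U
  iteration-⊆ S-attr r P-out C⊆U v∈S∪P with ∈∪⁻ v∈S∪P
  ... | inj₂ v∈P = proj₁ (Restricted.∈V'⁻ r (Answer.⊆V P-out v∈P))
  ... | inj₁ v∈S with safeAttr-inversion S-attr v∈S
  ...   | inj₁ v∈C           = C⊆U v∈C
  ...   | inj₂ (v∈U , _ , _) = v∈U

  iteration-below : ∀ {U l C S V' P} → IsSafeAttr G U l C σ S → IsRestrict G (U ─ S) l σ V' →
                    ParAlg V' P → ∀ {v} → v ∈ S ∪ P → v ∉ C → prio v <ℤ l
  iteration-below S-attr r P-out v∈S∪P v∉C with ∈∪⁻ v∈S∪P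
  ... | inj₂ v∈P = Restricted.V'-below r (Answer.⊆V P-out v∈P)
  ... | inj₁ v∈S with safeAttr-inversion S-attr v∈S
  ...   | inj₁ v∈C             = ⊥-elim (v∉C v∈C)
  ...   | inj₂ (_ , v<l , _) = v<l

  genAttr-⊆ : ∀ {U l C out} → GenLoop U l C out → C ⊆ U → out ⊆ U
  genAttr-⊆ (stop S-attr r P-out _)          = iteration-⊆ S-attr r P-out
  genAttr-⊆ (continue S-attr r P-out _ loop) = genAttr-⊆ loop ∘ iteration-⊆ S-attr r P-out

  genAttr-below : ∀ {U l C out} → GenLoop U l C out → ∀ {v} → v ∈ out → v ∉ C → prio v <ℤ l
  genAttr-below (stop S-attr r P-out _) = iteration-below S-attr r P-out
  genAttr-below (continue {S = S} {P = P} S-attr r P-out _ loop) {v} v∈out v∉C with v ∈? S ∪ P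
  ... | yes v∈S∪P = iteration-below S-attr r P-out v∈S∪P v∉C
  ... | no  v∉S∪P = genAttr-below loop v∈out v∉S∪P

  seqAttr-⊆ : ∀ {U W C out} → SeqLoop U W C out → W ⊆ U → C ⊆ U → out ⊆ U
  seqAttr-⊆ (done _) W⊆U C⊆U = C⊆U
  seqAttr-⊆ {W = W} (step _ _ gen loop) W⊆U C⊆U =
    seqAttr-⊆ loop (W⊆U ∘ ∈─⁻ˡ) (genAttr-⊆ gen ([ C⊆U , W⊆U ∘ proj₁ ∘ ∈atPrio⁻ W ]′ ∘ ∈∪⁻))

  seqAttr-dominated : ∀ {U W C out} → SeqLoop U W C out →
                      ∀ {v} → v ∈ out → v ∉ C → ∃ λ w → w ∈ W × prio v ≤ℤ prio w
  seqAttr-dominated (done _) v∈out v∉C = ⊥-elim (v∉C v∈out)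
  seqAttr-dominated {W = W} {C} (step {l = l} {C' = C'} _ ((m , m∈W , m≡l) , _) gen loop) {v} v∈out v∉C
    with v ∈? C' | v ∈? atPrio G W l
  ... | no v∉C' | _ = let (w , w∈W─C' , v≤w) = seqAttr-dominated loop v∈out v∉C' in
                       w , ∈─⁻ˡ w∈W─C' , v≤w
  ... | yes _    | yes v∈layer = v , proj₁ (∈atPrio⁻ W v∈layer) , ℤ.≤-refl
  ... | yes v∈C' | no  v∉layer =
    m , m∈W , subst (prio v ≤ℤ_) (sym m≡l) (ℤ.<⇒≤ (genAttr-below gen v∈C' ([ v∉C , v∉layer ]′ ∘ ∈∪⁻)))

  module Soundness (U T F : Subset n) (F⊆U : F ⊆ U) where
    record Invariant (C : Subset n) : Set where
      field
        within     : C ⊆ U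
        opp-closed : ∀ v → v ∈ C → owner G v ≡ opp σ → succ v ∩ U ⊆ C
        σ-escape   : ∀ v → v ∈ C → owner G v ≡ σ → v ∈ T ⊎ ∃ λ w → w ∈ succ v ∩ U × w ∈ C
        replies    : ∀ {Y} → LegalMove G (opp σ) F Y → Nonempty (Y ∩ C) → HasWinningReply k Y

    invariant-∅ : Invariant ∅
    invariant-∅ = record
      { within     = ⊥-elim ∘ ∉⊥
      ; opp-closed = λ _ v∈∅ → ⊥-elim (∉⊥ v∈∅)
      ; σ-escape   = λ _ v∈∅ → ⊥-elim (∉⊥ v∈∅)
      ; replies    = λ { _ (_ , y∈Y∩∅) → ⊥-elim (∉⊥ (∈∩⁻ʳ y∈Y∩∅)) }
      }

    invariant-safeAttr : ∀ {l C S} → IsSafeAttr G U l C σ S → S ⊆ F → Invariant C → Invariant S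
    invariant-safeAttr {S = S} S-attr S⊆F inv = record
      { within     = [ I.within , proj₁ ]′ ∘ safeAttr-inversion S-attr
      ; opp-closed = opp-closed
      ; σ-escape   = σ-escape
      ; replies    = λ Y-legal meets-S →
          I.replies Y-legal (safeAttr-meets-trap S-attr S⊆F F⊆U (opp²-trap (proj₁ (proj₂ Y-legal))) meets-S)
      }
      where
      module I = Invariant inv

      opp-closed : ∀ v → v ∈ S → owner G v ≡ opp σ → succ v ∩ U ⊆ S
      opp-closed v v∈S v-opp with safeAttr-inversion S-attr v∈S
      ... | inj₁ v∈C                      = safeAttr-⊇ S-attr ∘ I.opp-closed v v∈C v-opp
      ... | inj₂ (_ , _ , inj₁ (v-σ , _)) = ⊥-elim (≡∧≡opp⇒⊥ v-σ v-opp)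
      ... | inj₂ (_ , _ , inj₂ (_ , N⊆S)) = N⊆S

      σ-escape : ∀ v → v ∈ S → owner G v ≡ σ → v ∈ T ⊎ ∃ λ w → w ∈ succ v ∩ U × w ∈ S
      σ-escape v v∈S v-σ with safeAttr-inversion S-attr v∈S
      ... | inj₂ (_ , _ , inj₁ (_ , escape)) = inj₂ escape
      ... | inj₂ (_ , _ , inj₂ (v-opp , _))  = ⊥-elim (≡∧≡opp⇒⊥ v-σ v-opp)
      ... | inj₁ v∈C with I.σ-escape v v∈C v-σ
      ...   | inj₁ v∈T                 = inj₁ v∈T
      ...   | inj₂ (w , w∈N∩U , w∈C) = inj₂ (w , w∈N∩U , safeAttr-⊇ S-attr w∈C)

    -- the reply is found inside Y ∩ P, a subgame on which the answer P still wins within k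
    reply-via-answer : ∀ {l S V' P Y} → IsRestrict G (U ─ S) l σ V' → ParAlg V' P → P ⊆ F →
                       LegalMove G (opp σ) F Y → Empty (Y ∩ S) → Nonempty (Y ∩ P) →
                       HasWinningReply k Y
    reply-via-answer {P = P} {Y} r P-out P⊆F (_ , (Y⊆F , Y-closed , Y-escape) , _) misses-S (y , y∈Y∩P) =
      reply-lift k Z-trap-Y
        (subgame-reply k Z-subgame (y , y∈Y∩P) (wins-subtrap k (Answer.wins P-out (∈∩⁻ʳ y∈Y∩P)) Z-trap-P))
      where
      Z : Subset n
      Z = Y ∩ P

      opp-stays : ∀ {v} → v ∈ Z → owner G v ≡ opp σ → ∀ {w} → w ∈ succ v → w ∈ Y → w ∈ P
      opp-stays v∈Z v-opp {w} w∈N w∈Y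
        with Restricted.opp-successor r (Answer.⊆V P-out (∈∩⁻ʳ v∈Z)) v-opp w∈N (F⊆U (Y⊆F w∈Y))
      ... | inj₁ w∈S  = ⊥-elim (misses-S (w , ∈∩⁺ w∈Y w∈S))
      ... | inj₂ w∈V' = Answer.opp-closed P-out (∈∩⁻ʳ v∈Z) v-opp (∈∩⁺ w∈N w∈V')

      Z-subgame : IsSubgame Z
      Z-subgame v v∈Z with ≡-or-≡opp σ (owner G v)
      ... | inj₁ v-σ =
        let (w , w∈N∩V' , w∈P) = Answer.σ-escape P-out (∈∩⁻ʳ v∈Z) v-σ in
        w , ∈∩⁻ˡ w∈N∩V' ,
        ∈∩⁺ (Y-closed v (∈∩⁻ˡ v∈Z) (≡⇒≡opp² v-σ) (∈∩⁺ (∈∩⁻ˡ w∈N∩V') (P⊆F w∈P))) w∈P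
      ... | inj₂ v-opp =
        let (w , w∈N∩F , w∈Y) = Y-escape v (∈∩⁻ˡ v∈Z) (≡⇒≡opp² v-opp) in
        w , ∈∩⁻ˡ w∈N∩F , ∈∩⁺ w∈Y (opp-stays v∈Z v-opp (∈∩⁻ˡ w∈N∩F) w∈Y)

      Z-trap-P : IsTrap G P (opp (opp σ)) Z
      Z-trap-P = subgame⇒trap _ Z-subgame ∈∩⁻ʳ λ v v∈Z v-σ w∈N∩P →
        ∈∩⁺ (Y-closed v (∈∩⁻ˡ v∈Z) v-σ (∈∩⁺ (∈∩⁻ˡ w∈N∩P) (P⊆F (∈∩⁻ʳ w∈N∩P)))) (∈∩⁻ʳ w∈N∩P)

      Z-trap-Y : IsTrap G Y (opp σ) Z
      Z-trap-Y = subgame⇒trap _ Z-subgame ∈∩⁻ˡ λ v v∈Z v-opp w∈N∩Y →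
        ∈∩⁺ (∈∩⁻ʳ w∈N∩Y) (opp-stays v∈Z v-opp (∈∩⁻ˡ w∈N∩Y) (∈∩⁻ʳ w∈N∩Y))

    invariant-iteration : ∀ {l C S V' P} → IsSafeAttr G U l C σ S → IsRestrict G (U ─ S) l σ V' →
                          ParAlg V' P → S ∪ P ⊆ F → Invariant C → Invariant (S ∪ P)
    invariant-iteration {S = S} {V'} {P} S-attr r P-out S∪P⊆F inv = record
      { within     = iteration-⊆ S-attr r P-out (Invariant.within inv)
      ; opp-closed = opp-closed
      ; σ-escape   = σ-escape
      ; replies    = replies
      }
      where
      module I = Invariant (invariant-safeAttr S-attr (S∪P⊆F ∘ ∈∪ˡ) inv)

      opp-closed : ∀ v → v ∈ S ∪ P → owner G v ≡ opp σ → succ v ∩ U ⊆ S ∪ P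
      opp-closed v v∈S∪P v-opp w∈N∩U with ∈∪⁻ v∈S∪P
      ... | inj₁ v∈S = ∈∪ˡ (I.opp-closed v v∈S v-opp w∈N∩U)
      ... | inj₂ v∈P
        with Restricted.opp-successor r (Answer.⊆V P-out v∈P) v-opp (∈∩⁻ˡ w∈N∩U) (∈∩⁻ʳ w∈N∩U)
      ...   | inj₁ w∈S  = ∈∪ˡ w∈S
      ...   | inj₂ w∈V' = ∈∪ʳ (Answer.opp-closed P-out v∈P v-opp (∈∩⁺ (∈∩⁻ˡ w∈N∩U) w∈V'))

      σ-escape : ∀ v → v ∈ S ∪ P → owner G v ≡ σ → v ∈ T ⊎ ∃ λ w → w ∈ succ v ∩ U × w ∈ S ∪ P
      σ-escape v v∈S∪P v-σ with ∈∪⁻ v∈S∪P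
      ... | inj₂ v∈P =
        let (w , w∈N∩V' , w∈P) = Answer.σ-escape P-out v∈P v-σ in
        inj₂ (w , ∈∩⁺ (∈∩⁻ˡ w∈N∩V') (proj₁ (Restricted.∈V'⁻ r (∈∩⁻ʳ w∈N∩V'))) , ∈∪ʳ w∈P)
      ... | inj₁ v∈S with I.σ-escape v v∈S v-σ
      ...   | inj₁ v∈T                 = inj₁ v∈T
      ...   | inj₂ (w , w∈N∩U , w∈S) = inj₂ (w , w∈N∩U , ∈∪ˡ w∈S)

      replies : ∀ {Y} → LegalMove G (opp σ) F Y → Nonempty (Y ∩ (S ∪ P)) → HasWinningReply k Y
      replies {Y} Y-legal (y , y∈Y∩S∪P) with nonempty? (Y ∩ S) | ∈∪⁻ (∈∩⁻ʳ y∈Y∩S∪P)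
      ... | yes meets-S | _        = I.replies Y-legal meets-S
      ... | no misses-S | inj₁ y∈S = ⊥-elim (misses-S (y , ∈∩⁺ (∈∩⁻ˡ y∈Y∩S∪P) y∈S))
      ... | no misses-S | inj₂ y∈P =
        reply-via-answer r P-out (S∪P⊆F ∘ ∈∪ʳ) Y-legal misses-S (y , ∈∩⁺ (∈∩⁻ˡ y∈Y∩S∪P) y∈P)

    invariant-genAttr : ∀ {l C out} → GenLoop U l C out → out ⊆ F → Invariant C → Invariant out
    invariant-genAttr (stop S-attr r P-out _) out⊆F = invariant-iteration S-attr r P-out out⊆F
    invariant-genAttr (continue S-attr r P-out _ loop) out⊆F =
      invariant-genAttr loop out⊆F ∘ invariant-iteration S-attr r P-out (out⊆F ∘ genAttr-⊇ loop)

    OwnTargets : Subset n → Set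
    OwnTargets W = ∀ {w} → w ∈ W → w ∈ U × owner G w ≡ σ × w ∈ T

    invariant-layer : ∀ {W C l} → OwnTargets W → IsMaxPrio G W l →
                      (∀ {v} → v ∈ F → v ∉ C → ∃ λ w → w ∈ W × prio v ≤ℤ prio w) →
                      C ∪ atPrio G W l ⊆ F → Invariant C → Invariant (C ∪ atPrio G W l)
    invariant-layer {W} {C} {l} W-own (_ , W≤l) F-dominated layer⊆F inv = record
      { within     = [ I.within , proj₁ ∘ target ]′ ∘ ∈∪⁻
      ; opp-closed = opp-closed
      ; σ-escape   = σ-escape
      ; replies    = replies
      }
      where
      module I = Invariant inv

      target : ∀ {v} → v ∈ atPrio G W l → v ∈ U × owner G v ≡ σ × v ∈ T
      target = W-own ∘ proj₁ ∘ ∈atPrio⁻ W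

      opp-closed : ∀ v → v ∈ C ∪ atPrio G W l → owner G v ≡ opp σ → succ v ∩ U ⊆ C ∪ atPrio G W l
      opp-closed v v∈ v-opp with ∈∪⁻ v∈
      ... | inj₁ v∈C     = ∈∪ˡ ∘ I.opp-closed v v∈C v-opp
      ... | inj₂ v∈layer = ⊥-elim (≡∧≡opp⇒⊥ (proj₁ (proj₂ (target v∈layer))) v-opp)

      σ-escape : ∀ v → v ∈ C ∪ atPrio G W l → owner G v ≡ σ →
                 v ∈ T ⊎ ∃ λ w → w ∈ succ v ∩ U × w ∈ C ∪ atPrio G W l
      σ-escape v v∈ v-σ with ∈∪⁻ v∈
      ... | inj₂ v∈layer = inj₁ (proj₂ (proj₂ (target v∈layer)))
      ... | inj₁ v∈C with I.σ-escape v v∈C v-σ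
      ...   | inj₁ v∈T                 = inj₁ v∈T
      ...   | inj₂ (w , w∈N∩U , w∈C) = inj₂ (w , w∈N∩U , ∈∪ˡ w∈C)

      -- a move meeting the layer but missing C would have its top in the layer, owned by σ
      replies : ∀ {Y} → LegalMove G (opp σ) F Y → Nonempty (Y ∩ (C ∪ atPrio G W l)) → HasWinningReply k Y
      replies {Y} Y-legal@(Y-ne , (Y⊆F , _) , Y-max) (y , y∈Y∩) with nonempty? (Y ∩ C) | ∈∪⁻ (∈∩⁻ʳ y∈Y∩)
      ... | yes meets-C | _        = I.replies Y-legal meets-C
      ... | no misses-C | inj₁ y∈C = ⊥-elim (misses-C (y , ∈∩⁺ (∈∩⁻ˡ y∈Y∩) y∈C))
      ... | no misses-C | inj₂ y∈layer with maxOwnedBy⇒argmax (opp σ) Y-ne Y-max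
      ...   | m , (m∈Y , m-max) , m-opp
        with F-dominated (Y⊆F m∈Y) (λ m∈C → misses-C (m , ∈∩⁺ m∈Y m∈C))
      ...     | w , w∈W , m≤w =
        ⊥-elim (≡∧≡opp⇒⊥ (trans (owner-cong m≡y) (proj₁ (proj₂ (target y∈layer)))) m-opp)
        where
        m≡y : prio m ≡ prio y
        m≡y = ℤ.≤-antisym
          (ℤ.≤-trans m≤w (subst (prio w ≤ℤ_) (sym (proj₂ (∈atPrio⁻ W y∈layer))) (W≤l w w∈W)))
          (m-max y (∈∩⁻ˡ y∈Y∩))

    invariant-seqAttr : ∀ {W C} → SeqLoop U W C F → OwnTargets W → Invariant C → Invariant F
    invariant-seqAttr (done _) _ = id
    invariant-seqAttr loop@(step _ W-max gen rest) W-own =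
      invariant-seqAttr rest (W-own ∘ ∈─⁻ˡ) ∘
      invariant-genAttr gen (seqAttr-⊇ rest) ∘
      invariant-layer W-own W-max (seqAttr-dominated loop) (seqAttr-⊇ rest ∘ genAttr-⊇ gen)

  seqAttr-maxOwnedBy : ∀ {U W F} → SeqLoop U W ∅ F → (∀ {w} → w ∈ W → owner G w ≡ σ) →
                       MaxOwnedBy G σ F
  seqAttr-maxOwnedBy (done _) _ v v∈∅ _ = ⊥-elim (∉⊥ v∈∅)
  seqAttr-maxOwnedBy loop@(step _ ((m , m∈W , m≡l) , W≤l) gen rest) W-σ v v∈F v-max
    with seqAttr-dominated loop v∈F ∉⊥
  ... | w , w∈W , v≤w = trans (owner-cong (ℤ.≤-antisym v≤m (v-max m m∈F))) (W-σ m∈W)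
    where
    m∈F = seqAttr-⊇ rest (genAttr-⊇ gen (∈∪ʳ (∈atPrio⁺ m∈W m≡l)))
    v≤m = ℤ.≤-trans v≤w (subst (prio w ≤ℤ_) (sym m≡l) (W≤l w w∈W))

  tda-sound : ∀ {U T F} → TDALoop U T F → Nonempty F → LegalMove G σ U F × Wins G σ (suc k) F
  tda-sound (continue _ _ _ loop) = tda-sound loop
  tda-sound {U} {T} {F} (stop seq T'-pruned T'≡T) F-ne =
    (F-ne , (F⊆U , I.opp-closed , σ-escape) , seqAttr-maxOwnedBy seq (proj₂ ∘ ∈verticesOf⁻ U ∘ ∈∩⁻ˡ)) ,
    F-wins
    where
    F⊆U : F ⊆ U
    F⊆U = seqAttr-⊆ seq (proj₁ ∘ ∈verticesOf⁻ U ∘ ∈∩⁻ˡ) (⊥-elim ∘ ∉⊥)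

    open Soundness U T F F⊆U

    targets : OwnTargets (verticesOf G σ U ∩ T)
    targets w∈ = let (w∈U , w-σ) = ∈verticesOf⁻ U (∈∩⁻ˡ w∈) in w∈U , w-σ , ∈∩⁻ʳ w∈

    module I = Invariant (invariant-seqAttr seq targets invariant-∅)

    -- T is stable under pruning, so its σ-vertices in F keep a successor in F
    σ-escape : ∀ v → v ∈ F → owner G v ≡ opp (opp σ) → ∃ λ w → w ∈ succ v ∩ U × w ∈ F
    σ-escape v v∈F v-σ with I.σ-escape v v∈F (≡opp²⇒≡ v-σ)
    ... | inj₂ escape = escape
    ... | inj₁ v∈T with ¬Empty⇒Nonempty (λ stuck →
                          proj₂ (proj₁ (T'-pruned v) (subst (v ∈_) (sym T'≡T) v∈T))
                                (∈verticesOf⁺ (F⊆U v∈F) (≡opp²⇒≡ v-σ) , stuck))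
    ...   | w , w∈N∩U∩F = w , ∈∩⁺ (∈∩⁻ˡ w∈N∩U∩F) (∈∩⁻ˡ (∈∩⁻ʳ w∈N∩U∩F)) , ∈∩⁻ʳ (∈∩⁻ʳ w∈N∩U∩F)

    F-wins : Wins G σ (suc k) F
    F-wins Y Y-legal@((y , y∈Y) , (Y⊆F , _) , _) = I.replies Y-legal (y , ∈∩⁺ y∈Y (Y⊆F y∈Y))

  data Stable (U : Subset n) (l : ℤ) (C : Subset n) : Set where
    stable : ∀ {V' P} → SafeClosed G U l σ C → IsRestrict G (U ─ C) l σ V' → ParAlg V' P → P ⊆ C →
             Stable U l C

  genAttr-stable : ∀ {U l C out} → GenLoop U l C out → Stable U l out
  genAttr-stable (continue _ _ _ _ loop) = genAttr-stable loop
  genAttr-stable {U} {l} (stop {S = S} {V'} {P} ((S∪P⊆S , S-att) , _) r P-out refl) =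
    stable (subst (SafeClosed G U l σ) S≡S∪P S-att) (subst (λ D → IsRestrict G (U ─ D) l σ V') S≡S∪P r)
           P-out ∈∪ʳ
    where
    S≡S∪P : S ≡ S ∪ P
    S≡S∪P = ⊆-antisym ∈∪ˡ S∪P⊆S

  module Completeness {U X} (X-legal : LegalMove G σ U X) (X-wins : Wins G σ (suc k) X) where
    X⊆U : X ⊆ U
    X⊆U = proj₁ (proj₁ (proj₂ X-legal))

    X-opp-closed : ∀ v → v ∈ X → owner G v ≡ opp σ → succ v ∩ U ⊆ X
    X-opp-closed = proj₁ (proj₂ (proj₁ (proj₂ X-legal)))

    X-σ-escape : ∀ v → v ∈ X → owner G v ≡ σ → ∃ λ w → w ∈ succ v ∩ U × w ∈ X
    X-σ-escape v v∈X = proj₂ (proj₂ (proj₁ (proj₂ X-legal))) v v∈X ∘ ≡⇒≡opp²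

    module Remainder {l C V' P} (C-att : SafeClosed G U l σ C) (r : IsRestrict G (U ─ C) l σ V')
                     (P-out : ParAlg V' P) (P⊆C : P ⊆ C) (R-below : ∀ {v} → v ∈ X ─ C → prio v <ℤ l)
                     where
      open Restricted r

      R : Subset n
      R = X ─ C

      σ-stays : ∀ {v} → v ∈ R → owner G v ≡ σ → ∀ {w} → w ∈ succ v → w ∈ U → w ∉ C
      σ-stays {v} v∈R v-σ w∈N w∈U w∈C =
        ∈─⁻ʳ v∈R (proj₁ (C-att v (X⊆U (∈─⁻ˡ v∈R)) (R-below v∈R)) v-σ (_ , ∈∩⁺ w∈N w∈U , w∈C))

      σ-escape : ∀ {v} → v ∈ R → owner G v ≡ σ → ∃ λ w → w ∈ succ v ∩ U × w ∈ R
      σ-escape v∈R v-σ =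
        let (w , w∈N∩U , w∈X) = X-σ-escape _ (∈─⁻ˡ v∈R) v-σ in
        w , w∈N∩U , ∈─⁺ w∈X (σ-stays v∈R v-σ (∈∩⁻ˡ w∈N∩U) (∈∩⁻ʳ w∈N∩U))

      opp-escape : ∀ {v} → v ∈ R → owner G v ≡ opp σ → ∃ λ w → w ∈ succ v ∩ U × w ∈ R
      opp-escape {v} v∈R v-opp
        with ⊈⇒∃∉ (∈─⁻ʳ v∈R ∘ proj₂ (C-att v (X⊆U (∈─⁻ˡ v∈R)) (R-below v∈R)) v-opp)
      ... | w , w∈N∩U , w∉C = w , w∈N∩U , ∈─⁺ (X-opp-closed v (∈─⁻ˡ v∈R) v-opp w∈N∩U) w∉C

      -- A ─ R still contains the high priorities and is attractor-closed, so A misses R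
      R⊆V' : R ⊆ V'
      R⊆V' v∈R = ∈V'⁺ (X⊆U (∈─⁻ˡ v∈R)) (∈─⁻ʳ v∈R) (λ v∈A → ∈─⁻ʳ (A-least (A ─ R) (atLeast⊆A─R , A─R-att) v∈A) v∈R)
        where
        atLeast⊆A─R : atLeast G (U ─ C) l ⊆ A ─ R
        atLeast⊆A─R x∈ = ∈─⁺ (atLeast⊆A x∈) (λ x∈R → ℤ.<⇒≱ (R-below x∈R) (proj₂ (∈atLeast⁻ (U ─ C) x∈)))

        A─R-att : AttrClosed G (U ─ C) (opp σ) (A ─ R)
        A─R-att v v∈U─C =
          (λ v-opp (w , w∈N∩U─C , w∈A─R) →
             ∈─⁺ (proj₁ (A-att v v∈U─C) v-opp (w , w∈N∩U─C , ∈─⁻ˡ w∈A─R))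
                 (λ v∈R → ∈─⁻ʳ w∈A─R
                    (∈─⁺ (X-opp-closed v (∈─⁻ˡ v∈R) v-opp (∈∩⁺ (∈∩⁻ˡ w∈N∩U─C) (∈─⁻ˡ (∈∩⁻ʳ w∈N∩U─C))))
                         (∈─⁻ʳ (∈∩⁻ʳ w∈N∩U─C))))) ,
          (λ v-σ N⊆A─R →
             ∈─⁺ (proj₂ (A-att v v∈U─C) v-σ (∈─⁻ˡ ∘ N⊆A─R))
                 (λ v∈R → let (w , w∈N∩U , w∈R) = σ-escape v∈R (≡opp²⇒≡ v-σ) in
                          ∈─⁻ʳ (N⊆A─R (∈∩⁺ (∈∩⁻ˡ w∈N∩U) (∈─⁺ (∈∩⁻ʳ w∈N∩U) (∈─⁻ʳ w∈R)))) w∈R))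

      R-trap-V' : IsTrap G V' (opp σ) R
      R-trap-V' = R⊆V' ,
        (λ v v∈R v-opp w∈N∩V' →
           let (w∈U , w∉C , _) = ∈V'⁻ (∈∩⁻ʳ w∈N∩V') in
           ∈─⁺ (X-opp-closed v (∈─⁻ˡ v∈R) v-opp (∈∩⁺ (∈∩⁻ˡ w∈N∩V') w∈U)) w∉C) ,
        (λ v v∈R v-σ →
           let (w , w∈N∩U , w∈R) = σ-escape v∈R (≡opp²⇒≡ v-σ) in
           w , ∈∩⁺ (∈∩⁻ˡ w∈N∩U) (R⊆V' w∈R) , w∈R)

      R-trap-X : IsTrap G X (opp (opp σ)) R
      R-trap-X = ∈─⁻ˡ ,
        (λ v v∈R v-σ w∈N∩X →
           ∈─⁺ (∈∩⁻ʳ w∈N∩X) (σ-stays v∈R (≡opp²⇒≡ v-σ) (∈∩⁻ˡ w∈N∩X) (X⊆U (∈∩⁻ʳ w∈N∩X)))) ,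
        (λ v v∈R v-opp →
           let (w , w∈N∩U , w∈R) = opp-escape v∈R (≡opp²⇒≡ v-opp) in
           w , ∈∩⁺ (∈∩⁻ˡ w∈N∩U) (∈─⁻ˡ w∈R) , w∈R)

      -- were the top of R the opponent's, R would be a legal opponent move, and σ's winning reply
      -- would be a legal move in G[V'], hence inside P ⊆ C
      top-owned-by-σ : ∀ {m} → IsArgmax prio R m → owner G m ≡ σ
      top-owned-by-σ {m} m-max@(m∈R , _) with ≡-or-≡opp σ (owner G m)
      ... | inj₁ m-σ = m-σ
      ... | inj₂ m-opp with X-wins R ((m , m∈R) , R-trap-X , argmax⇒maxOwnedBy (opp σ) m-max m-opp)
      ...   | X' , (X'-ne@(x , x∈X') , X'-trap , X'-max) , X'-wins =
        ⊥-elim (∈─⁻ʳ (proj₁ X'-trap x∈X')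
                     (P⊆C (answer-complete P-out (X'-ne , trap-trans R-trap-V' X'-trap , X'-max) X'-wins x∈X')))

    record Covered (W C : Subset n) : Set where
      field
        W-σ       : ∀ {w} → w ∈ W → owner G w ≡ σ
        σ-covered : ∀ {v} → v ∈ X → owner G v ≡ σ → v ∈ C ⊎ v ∈ W
        dominated : ∀ {v} → v ∈ X → v ∉ C → ∃ λ w → w ∈ W × prio v ≤ℤ prio w

    covered-initial : ∀ {T} → (∀ {v} → v ∈ X → owner G v ≡ σ → v ∈ T) → Covered (verticesOf G σ U ∩ T) ∅
    covered-initial {T} X-σ⊆T = record
      { W-σ       = proj₂ ∘ ∈verticesOf⁻ U ∘ ∈∩⁻ˡ
      ; σ-covered = λ v∈X v-σ → inj₂ (target v∈X v-σ)
      ; dominated = λ v∈X _ →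
          let (m , (m∈X , m-max) , m-σ) = maxOwnedBy⇒argmax σ (proj₁ X-legal) (proj₂ (proj₂ X-legal)) in
          m , target m∈X m-σ , m-max _ v∈X
      }
      where
      target : ∀ {v} → v ∈ X → owner G v ≡ σ → v ∈ verticesOf G σ U ∩ T
      target v∈X v-σ = ∈∩⁺ (∈verticesOf⁺ (X⊆U v∈X) v-σ) (X-σ⊆T v∈X v-σ)

    covered-step : ∀ {W C l C'} → Covered W C → IsMaxPrio G W l →
                   GenLoop U l (C ∪ atPrio G W l) C' → Covered (W ─ C') C'
    covered-step {W} {C} {l} {C'} cov ((m , m∈W , m≡l) , W≤l) gen = record
      { W-σ       = W-σ ∘ ∈─⁻ˡ
      ; σ-covered = σ-covered′
      ; dominated = dominated′
      }
      where
      open Covered cov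

      collected : C ∪ atPrio G W l ⊆ C'
      collected = genAttr-⊇ gen

      σ-covered′ : ∀ {v} → v ∈ X → owner G v ≡ σ → v ∈ C' ⊎ v ∈ W ─ C'
      σ-covered′ {v} v∈X v-σ with σ-covered v∈X v-σ | v ∈? C'
      ... | inj₁ v∈C | _        = inj₁ (collected (∈∪ˡ v∈C))
      ... | inj₂ _   | yes v∈C' = inj₁ v∈C'
      ... | inj₂ v∈W | no v∉C'  = inj₂ (∈─⁺ v∈W v∉C')

      below : ∀ {v} → v ∈ X ─ C' → prio v <ℤ l
      below {v} v∈R with dominated (∈─⁻ˡ v∈R) (∈─⁻ʳ v∈R ∘ collected ∘ ∈∪ˡ) | prio v ≟ℤ l
      ... | w , w∈W , v≤w | no v≢l = ℤ.≤∧≢⇒< (ℤ.≤-trans v≤w (W≤l w w∈W)) v≢l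
      ... | _             | yes v≡l
        with σ-covered (∈─⁻ˡ v∈R) (trans (owner-cong (trans v≡l (sym m≡l))) (W-σ m∈W))
      ...   | inj₁ v∈C = ⊥-elim (∈─⁻ʳ v∈R (collected (∈∪ˡ v∈C)))
      ...   | inj₂ v∈W = ⊥-elim (∈─⁻ʳ v∈R (collected (∈∪ʳ (∈atPrio⁺ v∈W v≡l))))

      dominated′ : ∀ {v} → v ∈ X → v ∉ C' → ∃ λ w → w ∈ W ─ C' × prio v ≤ℤ prio w
      dominated′ {v} v∈X v∉C' with argmax prio (X ─ C') (v , ∈─⁺ v∈X v∉C') | genAttr-stable gen
      ... | top , top-max@(top∈R , R≤top) | stable C'-att r P-out P⊆C'
        with σ-covered (∈─⁻ˡ top∈R) (Remainder.top-owned-by-σ C'-att r P-out P⊆C' below top-max)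
      ...   | inj₁ top∈C = ⊥-elim (∈─⁻ʳ top∈R (collected (∈∪ˡ top∈C)))
      ...   | inj₂ top∈W = top , ∈─⁺ top∈W (∈─⁻ʳ top∈R) , R≤top v (∈─⁺ v∈X v∉C')

    seqAttr-complete : ∀ {W C out} → SeqLoop U W C out → Covered W C → X ⊆ out
    seqAttr-complete {C = C} (done W-empty) cov {v} v∈X with v ∈? C
    ... | yes v∈C = v∈C
    ... | no  v∉C = let (w , w∈W , _) = Covered.dominated cov v∈X v∉C in ⊥-elim (W-empty (w , w∈W))
    seqAttr-complete (step _ W-max gen loop) cov = seqAttr-complete loop (covered-step cov W-max gen)

    tda-complete : ∀ {T out} → TDALoop U T out → (∀ {v} → v ∈ X → owner G v ≡ σ → v ∈ T) → X ⊆ out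
    tda-complete (stop seq _ _) X-σ⊆T = seqAttr-complete seq (covered-initial X-σ⊆T)
    tda-complete (continue {C = C} {T' = T'} seq T'-pruned _ loop) X-σ⊆T = tda-complete loop X-σ⊆T'
      where
      X⊆C : X ⊆ C
      X⊆C = seqAttr-complete seq (covered-initial X-σ⊆T)

      X-σ⊆T' : ∀ {v} → v ∈ X → owner G v ≡ σ → v ∈ T'
      X-σ⊆T' {v} v∈X v-σ = proj₂ (T'-pruned v) (X-σ⊆T v∈X v-σ) λ (_ , stuck) →
        let (w , w∈N∩U , w∈X) = X-σ-escape v v∈X v-σ in
        stuck (w , ∈∩⁺ (∈∩⁻ˡ w∈N∩U) (∈∩⁺ (∈∩⁻ʳ w∈N∩U) (X⊆C w∈X)))

  TDA-correct : Correct TDA (suc k)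
  TDA-correct = record
    { exists   = tda-exists
    ; sound    = tda-sound
    ; complete = λ out X-legal X-wins →
        Completeness.tda-complete X-legal X-wins out
          (λ v∈X v-σ → ∈verticesOf⁺ (proj₁ (proj₁ (proj₂ X-legal)) v∈X) v-σ)
    }

TDAk-correct : ∀ {n} (G : Game n) σ k → TrapDepth.Correct G σ (TDAk G σ k) k
TDAk-correct G σ zero = record
  { exists   = λ _ → ∅ , refl
  ; sound    = λ { refl (_ , x∈∅) → ⊥-elim (∉⊥ x∈∅) }
  ; complete = λ _ _ ()
  }
TDAk-correct G σ (suc k) = TDAStep.TDA-correct G σ (TDAk G σ k) (TDAk-correct G σ k)

mainTheorem8 : ∀ {n} (G : Game n) (σ : Player) (k : ℕ) →
    (∃ λ S → TDAk G σ k Full S) ×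
    (∀ S → TDAk G σ k Full S →
      (Nonempty S → WinningFirstMove G σ k S) ×
      (∀ X → WinningFirstMove G σ k X → X ⊆ S))
mainTheorem8 G σ k = exists Full , λ S out → sound out , λ X (X-legal , X-wins) → complete out X-legal X-wins
  where open TrapDepth.Correct (TDAk-correct G σ k)
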